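{- For any integers $a,b\geq 2$, $N_2(K_{a,b,1})=a+b-1$.
   Context: For a connected graph $G=(V,E)$, $N_2(G)$ is the minimum $N$ such that there is a map $g:V\to\{0,1,*\}^N$ with the property that for all $x,y\in V$, the graph distance between $x$ and $y$ equals the number of positions $j$ in which the $j$-th entries of $g(x)$ and $g(y)$ are distinct and neither equals $*$. $K_{a,b,c}$ denotes the complete tripartite graph with parts of sizes $a,b,c$. -}

module Defs where

open import Data.Nat using (ℕ; zero; suc; _+_; _≤_)
open import Data.Fin using (Fin)
open import Data.Sum using (_⊎_; inj₁; inj₂)
open import Data.Product using (_×_; Σ)
open import Data.Vec using (Vec; []; _∷_)
open import Data.Unit using (⊤)
open import Data.Empty using (⊥)
open import Level using (0ℓ)

record Graph : Set₁ where
  field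
    V   : Set
    Adj : V → V → Set

open Graph public

data Walk (G : Graph) : V G → V G → ℕ → Set where
  here : ∀ {x} → Walk G x x 0
  step : ∀ {x y z k} → Adj G x y → Walk G y z k → Walk G x z (suc k)

IsDist : (G : Graph) → V G → V G → ℕ → Set
IsDist G x y d = Walk G x y d × (∀ k → Walk G x y k → d ≤ k)

Connected : Graph → Set
Connected G = ∀ x y → Σ ℕ (Walk G x y)

data Sym : Set where
  𝟎 𝟏 ✱ : Sym

contrib : Sym → Sym → ℕ
contrib 𝟎 𝟏 = 1
contrib 𝟏 𝟎 = 1
contrib _ _ = 0

sqDist : ∀ {N} → Vec Sym N → Vec Sym N → ℕ
sqDist [] [] = 0
sqDist (s ∷ u) (t ∷ v) = contrib s t + sqDist u v

IsAddressing : (G : Graph) (N : ℕ) → (V G → Vec Sym N) → Set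
IsAddressing G N g = ∀ x y → IsDist G x y (sqDist (g x) (g y))

HasAddressing : Graph → ℕ → Set
HasAddressing G N = Σ (V G → Vec Sym N) (IsAddressing G N)

N₂≡ : Graph → ℕ → Set
N₂≡ G n = HasAddressing G n × (∀ N → HasAddressing G N → n ≤ N)

Part₃ : ℕ → ℕ → ℕ → Set
Part₃ a b c = Fin a ⊎ (Fin b ⊎ Fin c)

adj₃ : ∀ {a b c} → Part₃ a b c → Part₃ a b c → Set
adj₃ (inj₁ _)        (inj₁ _)        = ⊥
adj₃ (inj₂ (inj₁ _)) (inj₂ (inj₁ _)) = ⊥
adj₃ (inj₂ (inj₂ _)) (inj₂ (inj₂ _)) = ⊥
adj₃ _ _ = ⊤

K : ℕ → ℕ → ℕ → Graph
K a b c = record { V = Part₃ a b c ; Adj = adj₃ }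

-- Upper bound: an explicit addressing of length a + b − 1, built from unit-vector blocks of
-- lengths a − 2 and b − 2 and three further coordinates.
--
-- Lower bound, in the manner of Graham and Pollak: for an addressing g of length N and integer
-- weights w on the vertices,
--   ∑ᵤ ∑ᵥ w(u) w(v) d(u,v) = ∑ⱼ 2 Zⱼ Oⱼ,
-- where Zⱼ (resp. Oⱼ) is the total weight of the vertices whose j-th symbol is 0 (resp. 1).
-- Put weights x and y on the two large parts and −(∑x + ∑y) on the remaining vertex; then the
-- left-hand side equals −2(∑x ∑y + ∑x² + ∑y²), which is negative when ∑x = ∑y unless x = y = 0.
-- If N < a + b − 1, the N + 1 linear conditions ∑x = ∑y and Zⱼ = 0 on (x, y) ∈ ℤᵃ⁺ᵇ have a
-- nonzero solution, at which both sides must vanish.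
module Submission where

open import Defs
open import Data.Nat as ℕ using (ℕ; zero; suc; z≤n; s≤s; _≤_)
import Data.Nat.Properties as ℕₚ
open import Data.Integer as ℤ using (ℤ; +_; -[1+_]; 0ℤ; 1ℤ; _+_; _*_; -_; _-_; +≤+)
import Data.Integer.Properties as ℤₚ
open import Data.Integer.Tactic.RingSolver using (solve-∀)
open import Algebra.Properties.CommutativeSemigroup ℤₚ.*-commutativeSemigroup using (x∙yz≈y∙xz)
open import Algebra.Properties.CommutativeSemigroup ℤₚ.+-commutativeSemigroup
  using () renaming (interchange to +-interchange)
open import Algebra.Properties.Semiring.Sum ℤₚ.+-*-semiring
  using (sum; sum-syntax; sum-cong-≗; sum-replicate-zero; ∑-distrib-+; *-distribˡ-sum)
open import Data.Fin as Fin using (Fin; zero; suc; _↑ˡ_; _↑ʳ_)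
open import Data.Vec as Vec using (Vec; []; _∷_)
open import Data.Vec.Functional using (Vector; _++_)
open import Data.Vec.Functional.Properties using (lookup-++ˡ; lookup-++ʳ)
open import Data.List as List using (List; length)
open import Data.List.Properties using (length-map; length-removeAt′; length-tabulate)
open import Data.List.Relation.Unary.All as All using (All; all?)
open import Data.List.Relation.Unary.All.Properties using (¬All⇒Any¬; ─⁻; map⁻; tabulate⁻)
open import Data.List.Relation.Unary.Any as Any using (Any; _─_)
open import Data.List.Relation.Unary.Any.Properties using (lookup-result)
open import Data.Product using (∃-syntax; _×_; _,_; proj₁; proj₂)
open import Data.Sum using (_⊎_; inj₁; inj₂; [_,_]′)
open import Data.Sum.Properties using (inj₁-injective; inj₂-injective)
open import Data.Unit using (tt)
open import Function using (_∘_; id)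
open import Relation.Nullary using (¬_; yes; no; contradiction)
open import Relation.Binary.PropositionalEquality

walk₀ : ∀ {G x y} → Walk G x y 0 → x ≡ y
walk₀ here = refl

walk₁ : ∀ {G x y} → Walk G x y 1 → Adj G x y
walk₁ (step x~y here) = x~y

isDist-unique : ∀ {G x y d d′} → IsDist G x y d → IsDist G x y d′ → d ≡ d′
isDist-unique (w , min) (w′ , min′) = ℕₚ.≤-antisym (min _ w′) (min′ _ w)

isDist-refl : ∀ {G} x → IsDist G x x 0
isDist-refl x = here , λ _ _ → z≤n

isDist-adjacent : ∀ {G x y} → x ≢ y → Adj G x y → IsDist G x y 1
isDist-adjacent x≢y x~y = step x~y here , λ
  { zero    w → contradiction (walk₀ w) x≢y
  ; (suc _) _ → s≤s z≤n }

isDist-common-neighbour : ∀ {G x y z} → x ≢ y → ¬ Adj G x y → Adj G x z → Adj G z y → IsDist G x y 2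
isDist-common-neighbour x≢y x≁y x~z z~y = step x~z (step z~y here) , λ
  { zero          w → contradiction (walk₀ w) x≢y
  ; (suc zero)    w → contradiction (walk₁ w) x≁y
  ; (suc (suc _)) _ → s≤s (s≤s z≤n) }

samePartDist : ∀ {n} → Fin n → Fin n → ℕ
samePartDist zero    zero    = 0
samePartDist (suc i) (suc j) = samePartDist i j
samePartDist _       _       = 2

samePartDist-refl : ∀ {n} (i : Fin n) → samePartDist i i ≡ 0
samePartDist-refl zero    = refl
samePartDist-refl (suc i) = samePartDist-refl i

samePartDist-≢ : ∀ {n} {i j : Fin n} → i ≢ j → samePartDist i j ≡ 2
samePartDist-≢ {i = zero}  {zero}  i≢j = contradiction refl i≢j
samePartDist-≢ {i = zero}  {suc _} _   = refl
samePartDist-≢ {i = suc _} {zero}  _   = refl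
samePartDist-≢ {i = suc i} {suc j} i≢j = samePartDist-≢ (i≢j ∘ cong suc)

isDist-independent : ∀ {G n} {f : Fin n → V G} z →
  (∀ {i j} → f i ≡ f j → i ≡ j) → (∀ i j → ¬ Adj G (f i) (f j)) →
  (∀ i → Adj G (f i) z) → (∀ j → Adj G z (f j)) →
  ∀ i j → IsDist G (f i) (f j) (samePartDist i j)
isDist-independent {G} {f = f} z f-inj indep to-z from-z i j with i Fin.≟ j
... | yes refl = subst (IsDist G (f i) (f i)) (sym (samePartDist-refl i)) (isDist-refl (f i))
... | no i≢j   = subst (IsDist G (f i) (f j)) (sym (samePartDist-≢ i≢j))
                   (isDist-common-neighbour (i≢j ∘ f-inj) (indep i j) (to-z i) (from-z j))

apex : ∀ {a b} → Part₃ a b 1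
apex = inj₂ (inj₂ zero)

distK : ∀ {a b} → Part₃ a b 1 → Part₃ a b 1 → ℕ
distK (inj₁ i)        (inj₁ j)        = samePartDist i j
distK (inj₂ (inj₁ k)) (inj₂ (inj₁ l)) = samePartDist k l
distK (inj₂ (inj₂ _)) (inj₂ (inj₂ _)) = 0
distK _               _               = 1

isDist-K : ∀ {a b} (u v : Part₃ a b 1) → IsDist (K a b 1) u v (distK u v)
isDist-K (inj₁ i)        (inj₁ j)        =
  isDist-independent apex inj₁-injective (λ _ _ ()) (λ _ → tt) (λ _ → tt) i j
isDist-K (inj₂ (inj₁ k)) (inj₂ (inj₁ l)) =
  isDist-independent apex (inj₁-injective ∘ inj₂-injective) (λ _ _ ()) (λ _ → tt) (λ _ → tt) k l
isDist-K (inj₂ (inj₂ zero)) (inj₂ (inj₂ zero)) = isDist-refl _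
isDist-K (inj₁ _)        (inj₂ _)        = isDist-adjacent (λ ()) tt
isDist-K (inj₂ (inj₁ _)) (inj₁ _)        = isDist-adjacent (λ ()) tt
isDist-K (inj₂ (inj₁ _)) (inj₂ (inj₂ _)) = isDist-adjacent (λ ()) tt
isDist-K (inj₂ (inj₂ _)) (inj₁ _)        = isDist-adjacent (λ ()) tt
isDist-K (inj₂ (inj₂ _)) (inj₂ (inj₁ _)) = isDist-adjacent (λ ()) tt

data Block (n : ℕ) : Set where
  zeros stars : Block n
  unit        : Fin n → Block n

unitVec : ∀ {n} → Fin n → Vec Sym n
unitVec zero    = 𝟏 ∷ Vec.replicate _ 𝟎
unitVec (suc i) = 𝟎 ∷ unitVec i

expand : ∀ {n} → Block n → Vec Sym n
expand zeros    = Vec.replicate _ 𝟎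
expand stars    = Vec.replicate _ ✱
expand (unit i) = unitVec i

blockDist : ∀ {n} → Block n → Block n → ℕ
blockDist (unit i) (unit j) = samePartDist i j
blockDist zeros    (unit _) = 1
blockDist (unit _) zeros    = 1
blockDist _        _        = 0

sqDist-++ : ∀ {m n} (x x′ : Vec Sym m) (y y′ : Vec Sym n) →
            sqDist (x Vec.++ y) (x′ Vec.++ y′) ≡ sqDist x x′ ℕ.+ sqDist y y′
sqDist-++ []      []        y y′ = refl
sqDist-++ (s ∷ x) (s′ ∷ x′) y y′ =
  trans (cong (contrib s s′ ℕ.+_) (sqDist-++ x x′ y y′)) (sym (ℕₚ.+-assoc (contrib s s′) _ _))

sqDist-𝟎𝟎 : ∀ n → sqDist (Vec.replicate n 𝟎) (Vec.replicate n 𝟎) ≡ 0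
sqDist-𝟎𝟎 zero    = refl
sqDist-𝟎𝟎 (suc n) = sqDist-𝟎𝟎 n

sqDist-✱ˡ : ∀ {n} (x : Vec Sym n) → sqDist (Vec.replicate n ✱) x ≡ 0
sqDist-✱ˡ []      = refl
sqDist-✱ˡ (_ ∷ x) = sqDist-✱ˡ x

sqDist-✱ʳ : ∀ {n} (x : Vec Sym n) → sqDist x (Vec.replicate n ✱) ≡ 0
sqDist-✱ʳ []      = refl
sqDist-✱ʳ (𝟎 ∷ x) = sqDist-✱ʳ x
sqDist-✱ʳ (𝟏 ∷ x) = sqDist-✱ʳ x
sqDist-✱ʳ (✱ ∷ x) = sqDist-✱ʳ x

sqDist-𝟎-unit : ∀ {n} (i : Fin n) → sqDist (Vec.replicate n 𝟎) (unitVec i) ≡ 1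
sqDist-𝟎-unit {suc n} zero    = cong suc (sqDist-𝟎𝟎 n)
sqDist-𝟎-unit         (suc i) = sqDist-𝟎-unit i

sqDist-unit-𝟎 : ∀ {n} (i : Fin n) → sqDist (unitVec i) (Vec.replicate n 𝟎) ≡ 1
sqDist-unit-𝟎 {suc n} zero    = cong suc (sqDist-𝟎𝟎 n)
sqDist-unit-𝟎         (suc i) = sqDist-unit-𝟎 i

sqDist-unit : ∀ {n} (i j : Fin n) → sqDist (unitVec i) (unitVec j) ≡ samePartDist i j
sqDist-unit {suc n} zero    zero    = sqDist-𝟎𝟎 n
sqDist-unit         zero    (suc j) = cong suc (sqDist-𝟎-unit j)
sqDist-unit         (suc i) zero    = cong suc (sqDist-unit-𝟎 i)
sqDist-unit         (suc i) (suc j) = sqDist-unit i j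

sqDist-expand : ∀ {n} (B C : Block n) → sqDist (expand B) (expand C) ≡ blockDist B C
sqDist-expand {n} zeros zeros    = sqDist-𝟎𝟎 n
sqDist-expand zeros    (unit j)  = sqDist-𝟎-unit j
sqDist-expand (unit i) zeros     = sqDist-unit-𝟎 i
sqDist-expand (unit i) (unit j)  = sqDist-unit i j
sqDist-expand stars    C         = sqDist-✱ˡ (expand C)
sqDist-expand {n} zeros stars    = sqDist-✱ʳ (Vec.replicate n 𝟎)
sqDist-expand (unit i) stars     = sqDist-✱ʳ (unitVec i)

record Layout (p q : ℕ) : Set where
  constructor layout
  field
    head₁ : Sym
    left  : Block p
    head₂ : Sym
    head₃ : Sym
    right : Block q

encode : ∀ {p q} → Layout p q → Vec Sym (suc (p ℕ.+ suc (suc q)))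
encode (layout s B t r C) = s ∷ (expand B Vec.++ (t ∷ r ∷ expand C))

layoutDist : ∀ {p q} → Layout p q → Layout p q → ℕ
layoutDist (layout s B t r C) (layout s′ B′ t′ r′ C′) =
  contrib s s′ ℕ.+ (blockDist B B′ ℕ.+ (contrib t t′ ℕ.+ (contrib r r′ ℕ.+ blockDist C C′)))

sqDist-encode : ∀ {p q} (L L′ : Layout p q) → sqDist (encode L) (encode L′) ≡ layoutDist L L′
sqDist-encode (layout s B t r C) (layout s′ B′ t′ r′ C′) =
  cong (contrib s s′ ℕ.+_) (trans (sqDist-++ (expand B) (expand B′) _ _)
    (cong₂ ℕ._+_ (sqDist-expand B B′)
                 (cong (λ d → contrib t t′ ℕ.+ (contrib r r′ ℕ.+ d)) (sqDist-expand C C′))))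

layoutK : ∀ {p q} → Part₃ (2 ℕ.+ p) (2 ℕ.+ q) 1 → Layout p q
layoutK (inj₁ zero)                    = layout 𝟏 zeros    𝟎 𝟎 stars
layoutK (inj₁ (suc zero))              = layout ✱ zeros    𝟏 𝟏 stars
layoutK (inj₁ (suc (suc i)))           = layout 𝟎 (unit i) 𝟎 ✱ zeros
layoutK (inj₂ (inj₁ zero))             = layout 𝟏 stars    𝟎 𝟏 zeros
layoutK (inj₂ (inj₁ (suc zero)))       = layout ✱ stars    𝟏 𝟎 zeros
layoutK (inj₂ (inj₁ (suc (suc k))))    = layout 𝟎 stars    𝟎 ✱ (unit k)
layoutK (inj₂ (inj₂ zero))             = layout 𝟎 zeros    𝟎 ✱ zeros

layoutDist-K : ∀ {p q} (u v : Part₃ (2 ℕ.+ p) (2 ℕ.+ q) 1) → layoutDist (layoutK u) (layoutK v) ≡ distK u v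
layoutDist-K (inj₁ zero)                 (inj₁ zero)                 = refl
layoutDist-K (inj₁ zero)                 (inj₁ (suc zero))           = refl
layoutDist-K (inj₁ zero)                 (inj₁ (suc (suc _)))        = refl
layoutDist-K (inj₁ zero)                 (inj₂ (inj₁ zero))          = refl
layoutDist-K (inj₁ zero)                 (inj₂ (inj₁ (suc zero)))    = refl
layoutDist-K (inj₁ zero)                 (inj₂ (inj₁ (suc (suc _)))) = refl
layoutDist-K (inj₁ zero)                 (inj₂ (inj₂ zero))          = refl
layoutDist-K (inj₁ (suc zero))           (inj₁ zero)                 = refl
layoutDist-K (inj₁ (suc zero))           (inj₁ (suc zero))           = refl
layoutDist-K (inj₁ (suc zero))           (inj₁ (suc (suc _)))        = refl
layoutDist-K (inj₁ (suc zero))           (inj₂ (inj₁ zero))          = refl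
layoutDist-K (inj₁ (suc zero))           (inj₂ (inj₁ (suc zero)))    = refl
layoutDist-K (inj₁ (suc zero))           (inj₂ (inj₁ (suc (suc _)))) = refl
layoutDist-K (inj₁ (suc zero))           (inj₂ (inj₂ zero))          = refl
layoutDist-K (inj₁ (suc (suc _)))        (inj₁ zero)                 = refl
layoutDist-K (inj₁ (suc (suc _)))        (inj₁ (suc zero))           = refl
layoutDist-K (inj₁ (suc (suc i)))        (inj₁ (suc (suc j)))        = ℕₚ.+-identityʳ (samePartDist i j)
layoutDist-K (inj₁ (suc (suc _)))        (inj₂ (inj₁ zero))          = refl
layoutDist-K (inj₁ (suc (suc _)))        (inj₂ (inj₁ (suc zero)))    = refl
layoutDist-K (inj₁ (suc (suc _)))        (inj₂ (inj₁ (suc (suc _)))) = refl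
layoutDist-K (inj₁ (suc (suc _)))        (inj₂ (inj₂ zero))          = refl
layoutDist-K (inj₂ (inj₁ zero))          (inj₁ zero)                 = refl
layoutDist-K (inj₂ (inj₁ zero))          (inj₁ (suc zero))           = refl
layoutDist-K (inj₂ (inj₁ zero))          (inj₁ (suc (suc _)))        = refl
layoutDist-K (inj₂ (inj₁ zero))          (inj₂ (inj₁ zero))          = refl
layoutDist-K (inj₂ (inj₁ zero))          (inj₂ (inj₁ (suc zero)))    = refl
layoutDist-K (inj₂ (inj₁ zero))          (inj₂ (inj₁ (suc (suc _)))) = refl
layoutDist-K (inj₂ (inj₁ zero))          (inj₂ (inj₂ zero))          = refl
layoutDist-K (inj₂ (inj₁ (suc zero)))    (inj₁ zero)                 = refl
layoutDist-K (inj₂ (inj₁ (suc zero)))    (inj₁ (suc zero))           = refl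
layoutDist-K (inj₂ (inj₁ (suc zero)))    (inj₁ (suc (suc _)))        = refl
layoutDist-K (inj₂ (inj₁ (suc zero)))    (inj₂ (inj₁ zero))          = refl
layoutDist-K (inj₂ (inj₁ (suc zero)))    (inj₂ (inj₁ (suc zero)))    = refl
layoutDist-K (inj₂ (inj₁ (suc zero)))    (inj₂ (inj₁ (suc (suc _)))) = refl
layoutDist-K (inj₂ (inj₁ (suc zero)))    (inj₂ (inj₂ zero))          = refl
layoutDist-K (inj₂ (inj₁ (suc (suc _)))) (inj₁ zero)                 = refl
layoutDist-K (inj₂ (inj₁ (suc (suc _)))) (inj₁ (suc zero))           = refl
layoutDist-K (inj₂ (inj₁ (suc (suc _)))) (inj₁ (suc (suc _)))        = refl
layoutDist-K (inj₂ (inj₁ (suc (suc _)))) (inj₂ (inj₁ zero))          = refl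
layoutDist-K (inj₂ (inj₁ (suc (suc _)))) (inj₂ (inj₁ (suc zero)))    = refl
layoutDist-K (inj₂ (inj₁ (suc (suc _)))) (inj₂ (inj₁ (suc (suc _)))) = refl
layoutDist-K (inj₂ (inj₁ (suc (suc _)))) (inj₂ (inj₂ zero))          = refl
layoutDist-K (inj₂ (inj₂ zero))          (inj₁ zero)                 = refl
layoutDist-K (inj₂ (inj₂ zero))          (inj₁ (suc zero))           = refl
layoutDist-K (inj₂ (inj₂ zero))          (inj₁ (suc (suc _)))        = refl
layoutDist-K (inj₂ (inj₂ zero))          (inj₂ (inj₁ zero))          = refl
layoutDist-K (inj₂ (inj₂ zero))          (inj₂ (inj₁ (suc zero)))    = refl
layoutDist-K (inj₂ (inj₂ zero))          (inj₂ (inj₁ (suc (suc _)))) = refl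
layoutDist-K (inj₂ (inj₂ zero))          (inj₂ (inj₂ zero))          = refl

addressingK : ∀ {p q} → IsAddressing (K (2 ℕ.+ p) (2 ℕ.+ q) 1) (suc (p ℕ.+ suc (suc q))) (encode ∘ layoutK)
addressingK u v = subst (IsDist (K _ _ 1) u v)
  (sym (trans (sqDist-encode (layoutK u) (layoutK v)) (layoutDist-K u v))) (isDist-K u v)

infix 7 _·_

_·_ : ∀ {n} → Vector ℤ n → Vector ℤ n → ℤ
e · x = ∑[ i < _ ] (e i * x i)

∑-zero : ∀ {n} {f : Vector ℤ n} → (∀ i → f i ≡ 0ℤ) → sum f ≡ 0ℤ
∑-zero {n} f≗0 = trans (sum-cong-≗ f≗0) (sum-replicate-zero n)

∑-↑ : ∀ m {n} (f : Vector ℤ (m ℕ.+ n)) → sum f ≡ sum (f ∘ (_↑ˡ n)) + sum (f ∘ (m ↑ʳ_))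
∑-↑ zero    f = sym (ℤₚ.+-identityˡ (sum f))
∑-↑ (suc m) f = trans (cong (_+_ (f zero)) (∑-↑ m (f ∘ suc))) (sym (ℤₚ.+-assoc (f zero) _ _))

·-++ : ∀ {m n} (f : Vector ℤ m) (g : Vector ℤ n) v →
       (f ++ g) · v ≡ f · (v ∘ (_↑ˡ n)) + g · (v ∘ (m ↑ʳ_))
·-++ {m} f g v = trans (∑-↑ m _) (cong₂ _+_
  (sum-cong-≗ (λ i → cong (_* _) (lookup-++ˡ f g i)))
  (sum-cong-≗ (λ k → cong (_* _) (lookup-++ʳ f g k))))

‖_‖² : ∀ {n} → Vector ℤ n → ℤ
‖ x ‖² = ∑[ i < _ ] (x i * x i)

0≤i*i : ∀ i → 0ℤ ℤ.≤ i * i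
0≤i*i (+ n)    = subst (0ℤ ℤ.≤_) (sym (ℤₚ.+◃n≡+n (n ℕ.* n))) (+≤+ z≤n)
0≤i*i -[1+ n ] = subst (0ℤ ℤ.≤_) (sym (ℤₚ.+◃n≡+n (suc n ℕ.* suc n))) (+≤+ z≤n)

i+j≡0⇒i≡0 : ∀ {i j} → 0ℤ ℤ.≤ i → 0ℤ ℤ.≤ j → i + j ≡ 0ℤ → i ≡ 0ℤ
i+j≡0⇒i≡0 {i} {j} 0≤i 0≤j i+j≡0 =
  ℤₚ.≤-antisym (subst (i ℤ.≤_) i+j≡0 (ℤₚ.i≤i+j i j {{ℤ.nonNegative 0≤j}})) 0≤i

i+j≡0⇒j≡0 : ∀ {i j} → 0ℤ ℤ.≤ i → 0ℤ ℤ.≤ j → i + j ≡ 0ℤ → j ≡ 0ℤ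
i+j≡0⇒j≡0 {i} {j} 0≤i 0≤j i+j≡0 = i+j≡0⇒i≡0 0≤j 0≤i (trans (ℤₚ.+-comm j i) i+j≡0)

0≤‖‖² : ∀ {n} (x : Vector ℤ n) → 0ℤ ℤ.≤ ‖ x ‖²
0≤‖‖² {zero}  x = +≤+ z≤n
0≤‖‖² {suc n} x = ℤₚ.+-mono-≤ (0≤i*i (x zero)) (0≤‖‖² (x ∘ suc))

‖‖²≡0⇒≡0 : ∀ {n} (x : Vector ℤ n) → ‖ x ‖² ≡ 0ℤ → ∀ i → x i ≡ 0ℤ
‖‖²≡0⇒≡0 x ‖x‖²≡0 zero    = [ id , id ]′ (ℤₚ.i*j≡0⇒i≡0∨j≡0 (x zero)
                               (i+j≡0⇒i≡0 (0≤i*i (x zero)) (0≤‖‖² (x ∘ suc)) ‖x‖²≡0))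
‖‖²≡0⇒≡0 x ‖x‖²≡0 (suc i) = ‖‖²≡0⇒≡0 (x ∘ suc)
                               (i+j≡0⇒j≡0 (0≤i*i (x zero)) (0≤‖‖² (x ∘ suc)) ‖x‖²≡0) i

∑-*-identityʳ : ∀ {n} (x : Vector ℤ n) → ∑[ i < n ] (x i * 1ℤ) ≡ sum x
∑-*-identityʳ x = sum-cong-≗ (λ i → ℤₚ.*-identityʳ (x i))

∑-*-affine : ∀ {n} (x : Vector ℤ n) c k → ∑[ i < n ] (x i * (c + k * x i)) ≡ c * sum x + k * ‖ x ‖²
∑-*-affine x c k = begin
  ∑[ i < _ ] (x i * (c + k * x i))           ≡⟨ sum-cong-≗ (λ i → distribute (x i) c k) ⟩
  ∑[ i < _ ] (c * x i + k * (x i * x i))     ≡⟨ ∑-distrib-+ (λ i → c * x i) (λ i → k * (x i * x i)) ⟩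
  ∑[ i < _ ] (c * x i) + ∑[ i < _ ] (k * (x i * x i))
    ≡⟨ sym (cong₂ _+_ (*-distribˡ-sum c x) (*-distribˡ-sum k (λ i → x i * x i))) ⟩
  c * sum x + k * ‖ x ‖² ∎
  where
  open ≡-Reasoning
  distribute : ∀ x c k → x * (c + k * x) ≡ c * x + k * (x * x)
  distribute = solve-∀

∑-*-samePartDist : ∀ {n} (x : Vector ℤ n) i →
                   ∑[ j < n ] (x j * + samePartDist i j) ≡ + 2 * sum x + -[1+ 1 ] * x i
∑-*-samePartDist x zero = trans (cong (_+_ (x zero * 0ℤ)) (trans (sum-cong-≗ (λ j → ℤₚ.*-comm (x (suc j)) (+ 2)))
                                                                  (sym (*-distribˡ-sum (+ 2) (x ∘ suc)))))
                                (rearrange (x zero) (sum (x ∘ suc)))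
  where
  rearrange : ∀ x₀ s → x₀ * 0ℤ + + 2 * s ≡ + 2 * (x₀ + s) + -[1+ 1 ] * x₀
  rearrange = solve-∀
∑-*-samePartDist x (suc i) = trans (cong (_+_ (x zero * + 2)) (∑-*-samePartDist (x ∘ suc) i))
                                   (rearrange (x zero) (sum (x ∘ suc)) (x (suc i)))
  where
  rearrange : ∀ x₀ s xᵢ → x₀ * + 2 + (+ 2 * s + -[1+ 1 ] * xᵢ) ≡ + 2 * (x₀ + s) + -[1+ 1 ] * xᵢ
  rearrange = solve-∀

IsNonzero : ∀ {n} → Vector ℤ n → Set
IsNonzero x = ∃[ i ] x i ≢ 0ℤ

eliminate : ∀ {n} → Vector ℤ (suc n) → Vector ℤ (suc n) → Vector ℤ n
eliminate e r k = e zero * r (suc k) - r zero * e (suc k)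

extend : ∀ {n} → Vector ℤ (suc n) → Vector ℤ n → Vector ℤ (suc n)
extend e y zero    = - ∑[ k < _ ] (e (suc k) * y k)
extend e y (suc k) = e zero * y k

·-extend : ∀ {n} (e r : Vector ℤ (suc n)) y → r · extend e y ≡ eliminate e r · y
·-extend e r y = begin
  r₀ * - sum eʸ + ∑[ k < _ ] (r (suc k) * (e₀ * y k))
    ≡⟨ cong (_+_ (r₀ * - sum eʸ)) (sum-cong-≗ (λ k → x∙yz≈y∙xz (r (suc k)) e₀ (y k))) ⟩
  r₀ * - sum eʸ + ∑[ k < _ ] (e₀ * rʸ k)
    ≡⟨ cong (_+_ (r₀ * - sum eʸ)) (sym (*-distribˡ-sum e₀ rʸ)) ⟩
  r₀ * - sum eʸ + e₀ * sum rʸ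
    ≡⟨ rearrange r₀ (sum eʸ) e₀ (sum rʸ) ⟩
  e₀ * sum rʸ + - r₀ * sum eʸ
    ≡⟨ cong₂ _+_ (*-distribˡ-sum e₀ rʸ) (*-distribˡ-sum (- r₀) eʸ) ⟩
  ∑[ k < _ ] (e₀ * rʸ k) + ∑[ k < _ ] (- r₀ * eʸ k)
    ≡⟨ sym (∑-distrib-+ (λ k → e₀ * rʸ k) (λ k → - r₀ * eʸ k)) ⟩
  ∑[ k < _ ] (e₀ * rʸ k + - r₀ * eʸ k)
    ≡⟨ sum-cong-≗ (λ k → collect e₀ (r (suc k)) r₀ (e (suc k)) (y k)) ⟩
  eliminate e r · y ∎
  where
  open ≡-Reasoning
  e₀ = e zero
  r₀ = r zero
  eʸ rʸ : Vector ℤ _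
  eʸ k = e (suc k) * y k
  rʸ k = r (suc k) * y k
  rearrange : ∀ r₀ E e₀ R → r₀ * - E + e₀ * R ≡ e₀ * R + - r₀ * E
  rearrange = solve-∀
  collect : ∀ e₀ rₖ r₀ eₖ yₖ → e₀ * (rₖ * yₖ) + - r₀ * (eₖ * yₖ) ≡ (e₀ * rₖ - r₀ * eₖ) * yₖ
  collect = solve-∀

∃-nonzero-solution : ∀ {n} (es : List (Vector ℤ n)) → length es ℕ.< n →
                     ∃[ x ] IsNonzero x × All (λ e → e · x ≡ 0ℤ) es
∃-nonzero-solution {zero}  es ()
∃-nonzero-solution {suc n} es len<
  with all? (λ e → e zero ℤ.≟ 0ℤ) es
... | yes vanish = δ₀ , (zero , λ ()) , All.map (λ {e} → ·-δ₀ {e}) vanish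
  where
  δ₀ : Vector ℤ (suc n)
  δ₀ zero    = 1ℤ
  δ₀ (suc _) = 0ℤ
  ·-δ₀ : ∀ {e} → e zero ≡ 0ℤ → e · δ₀ ≡ 0ℤ
  ·-δ₀ {e} e₀≡0 = cong₂ _+_ (cong (_* 1ℤ) e₀≡0) (∑-zero (λ k → ℤₚ.*-zeroʳ (e (suc k))))
... | no ¬vanish = extend e y , nonzero , ─⁻ pivot e⊥x (All.map (λ {r} → trans (·-extend e r y)) (map⁻ rs⊥y))
  where
  pivot : Any (λ e → e zero ≢ 0ℤ) es
  pivot = ¬All⇒Any¬ (λ e → e zero ℤ.≟ 0ℤ) es ¬vanish
  e : Vector ℤ (suc n)
  e = Any.lookup pivot
  rs : List (Vector ℤ (suc n))
  rs = es ─ pivot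
  rs< : length (List.map (eliminate e) rs) ℕ.< n
  rs< = subst (ℕ._< n) (sym (length-map (eliminate e) rs))
          (ℕₚ.≤-pred (subst (ℕ._< suc n) (length-removeAt′ es (Any.index pivot)) len<))
  solution : ∃[ y ] IsNonzero y × All (λ r → r · y ≡ 0ℤ) (List.map (eliminate e) rs)
  solution = ∃-nonzero-solution (List.map (eliminate e) rs) rs<
  y : Vector ℤ n
  y = proj₁ solution
  e⊥x : e · extend e y ≡ 0ℤ
  e⊥x = trans (·-extend e e y) (∑-zero (λ k → cong (_* y k) (ℤₚ.+-inverseʳ (e zero * e (suc k)))))
  rs⊥y : All (λ r → r · y ≡ 0ℤ) (List.map (eliminate e) rs)
  rs⊥y = proj₂ (proj₂ solution)
  nonzero : IsNonzero (extend e y)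
  nonzero with proj₁ (proj₂ solution)
  ... | t , yₜ≢0 = suc t , λ e₀yₜ≡0 →
    [ lookup-result pivot , yₜ≢0 ]′ (ℤₚ.i*j≡0⇒i≡0∨j≡0 (e zero) e₀yₜ≡0)

record Summation (V : Set) : Set where
  field
    ∑ᵥ      : (V → ℤ) → ℤ
    ∑ᵥ-cong : ∀ {f g} → f ≗ g → ∑ᵥ f ≡ ∑ᵥ g
    ∑ᵥ-+    : ∀ f g → ∑ᵥ (λ u → f u + g u) ≡ ∑ᵥ f + ∑ᵥ g
    ∑ᵥ-*    : ∀ c f → ∑ᵥ (λ u → c * f u) ≡ c * ∑ᵥ f

finSummation : ∀ n → Summation (Fin n)
finSummation n = record
  { ∑ᵥ      = sum
  ; ∑ᵥ-cong = sum-cong-≗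
  ; ∑ᵥ-+    = ∑-distrib-+
  ; ∑ᵥ-*    = λ c f → sym (*-distribˡ-sum c f)
  }

⊎-summation : ∀ {A B} → Summation A → Summation B → Summation (A ⊎ B)
⊎-summation {A} {B} SA SB = record
  { ∑ᵥ      = ∑⊎
  ; ∑ᵥ-cong = λ f≗g → cong₂ _+_ (A.∑ᵥ-cong (f≗g ∘ inj₁)) (B.∑ᵥ-cong (f≗g ∘ inj₂))
  ; ∑ᵥ-+    = ∑⊎-+
  ; ∑ᵥ-*    = λ c f → trans (cong₂ _+_ (A.∑ᵥ-* c (f ∘ inj₁)) (B.∑ᵥ-* c (f ∘ inj₂)))
                            (sym (ℤₚ.*-distribˡ-+ c _ _))
  }
  where
  module A = Summation SA
  module B = Summation SB
  ∑⊎ : (A ⊎ B → ℤ) → ℤ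
  ∑⊎ f = A.∑ᵥ (f ∘ inj₁) + B.∑ᵥ (f ∘ inj₂)
  ∑⊎-+ : ∀ f g → ∑⊎ (λ u → f u + g u) ≡ ∑⊎ f + ∑⊎ g
  ∑⊎-+ f g = trans (cong₂ _+_ (A.∑ᵥ-+ (f ∘ inj₁) (g ∘ inj₁)) (B.∑ᵥ-+ (f ∘ inj₂) (g ∘ inj₂)))
                   (+-interchange (A.∑ᵥ (f ∘ inj₁)) (A.∑ᵥ (g ∘ inj₁)) (B.∑ᵥ (f ∘ inj₂)) (B.∑ᵥ (g ∘ inj₂)))

is𝟎 is𝟏 : Sym → ℤ
is𝟎 𝟎 = 1ℤ
is𝟎 _ = 0ℤ
is𝟏 𝟏 = 1ℤ
is𝟏 _ = 0ℤ

contrib-split : ∀ s t → + contrib s t ≡ is𝟎 s * is𝟏 t + is𝟏 s * is𝟎 t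
contrib-split 𝟎 𝟎 = refl
contrib-split 𝟎 𝟏 = refl
contrib-split 𝟎 ✱ = refl
contrib-split 𝟏 𝟎 = refl
contrib-split 𝟏 𝟏 = refl
contrib-split 𝟏 ✱ = refl
contrib-split ✱ 𝟎 = refl
contrib-split ✱ 𝟏 = refl
contrib-split ✱ ✱ = refl

sqDist-lookup : ∀ {N} (x y : Vec Sym N) →
                + sqDist x y ≡ ∑[ j < N ] (+ contrib (Vec.lookup x j) (Vec.lookup y j))
sqDist-lookup []      []      = refl
sqDist-lookup (s ∷ x) (t ∷ y) =
  trans (ℤₚ.pos-+ (contrib s t) (sqDist x y)) (cong (_+_ (+ contrib s t)) (sqDist-lookup x y))

module QuadraticForm {V : Set} (S : Summation V) where

  open Summation S

  quadForm : (V → ℤ) → (V → V → ℤ) → ℤ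
  quadForm w d = ∑ᵥ λ u → w u * ∑ᵥ λ v → w v * d u v

  ∑ᵥ-zero : ∑ᵥ (λ _ → 0ℤ) ≡ 0ℤ
  ∑ᵥ-zero = ∑ᵥ-* 0ℤ (λ _ → 0ℤ)

  quadForm-cong : ∀ w {d d′} → (∀ u v → d u v ≡ d′ u v) → quadForm w d ≡ quadForm w d′
  quadForm-cong w d≡d′ = ∑ᵥ-cong λ u → cong (w u *_) (∑ᵥ-cong λ v → cong (w v *_) (d≡d′ u v))

  quadForm-zero : ∀ w → quadForm w (λ _ _ → 0ℤ) ≡ 0ℤ
  quadForm-zero w = trans (∑ᵥ-cong λ u → trans (cong (w u *_) (∑ᵥ-cong λ v → ℤₚ.*-zeroʳ (w v)))
                                              (trans (cong (w u *_) ∑ᵥ-zero) (ℤₚ.*-zeroʳ (w u))))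
                          ∑ᵥ-zero

  quadForm-+ : ∀ w (d d′ : V → V → ℤ) → quadForm w (λ u v → d u v + d′ u v) ≡ quadForm w d + quadForm w d′
  quadForm-+ w d d′ = trans (∑ᵥ-cong row) (∑ᵥ-+ _ _)
    where
    row : ∀ u → w u * ∑ᵥ (λ v → w v * (d u v + d′ u v))
              ≡ w u * ∑ᵥ (λ v → w v * d u v) + w u * ∑ᵥ (λ v → w v * d′ u v)
    row u = trans (cong (w u *_) (trans (∑ᵥ-cong λ v → ℤₚ.*-distribˡ-+ (w v) (d u v) (d′ u v)) (∑ᵥ-+ _ _)))
                  (ℤₚ.*-distribˡ-+ (w u) _ _)

  quadForm-⊗ : ∀ w (f g : V → ℤ) → quadForm w (λ u v → f u * g v)
                       ≡ ∑ᵥ (λ u → w u * f u) * ∑ᵥ (λ v → w v * g v)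
  quadForm-⊗ w f g = begin
    ∑ᵥ (λ u → w u * ∑ᵥ λ v → w v * (f u * g v))   ≡⟨ ∑ᵥ-cong (λ u → cong (w u *_) (inner u)) ⟩
    ∑ᵥ (λ u → w u * (f u * G))                     ≡⟨ ∑ᵥ-cong (λ u → shuffle (w u) (f u) G) ⟩
    ∑ᵥ (λ u → G * (w u * f u))                     ≡⟨ ∑ᵥ-* G (λ u → w u * f u) ⟩
    G * ∑ᵥ (λ u → w u * f u)                       ≡⟨ ℤₚ.*-comm G (∑ᵥ (λ u → w u * f u)) ⟩
    ∑ᵥ (λ u → w u * f u) * G                       ∎
    where
    open ≡-Reasoning
    G = ∑ᵥ (λ v → w v * g v)
    inner : ∀ u → ∑ᵥ (λ v → w v * (f u * g v)) ≡ f u * G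
    inner u = trans (∑ᵥ-cong λ v → x∙yz≈y∙xz (w v) (f u) (g v)) (∑ᵥ-* (f u) (λ v → w v * g v))
    shuffle : ∀ a b c → a * (b * c) ≡ c * (a * b)
    shuffle = solve-∀

  quadForm-∑ : ∀ {N} w (c : Fin N → V → V → ℤ) →
               quadForm w (λ u v → ∑[ j < N ] c j u v) ≡ ∑[ j < N ] quadForm w (c j)
  quadForm-∑ {zero}  w c = quadForm-zero w
  quadForm-∑ {suc N} w c = trans (quadForm-+ w (c zero) _) (cong (_+_ (quadForm w (c zero))) (quadForm-∑ w (c ∘ suc)))

  mass : ∀ {N} → (V → ℤ) → (V → Vec Sym N) → (Sym → ℤ) → Fin N → ℤ
  mass w g χ j = ∑ᵥ λ u → w u * χ (Vec.lookup (g u) j)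

  quadForm-sqDist : ∀ {N} w (g : V → Vec Sym N) →
    quadForm w (λ u v → + sqDist (g u) (g v))
      ≡ ∑[ j < N ] (mass w g is𝟎 j * mass w g is𝟏 j + mass w g is𝟏 j * mass w g is𝟎 j)
  quadForm-sqDist w g = begin
    quadForm w (λ u v → + sqDist (g u) (g v))
      ≡⟨ quadForm-cong w (λ u v → sqDist-lookup (g u) (g v)) ⟩
    quadForm w (λ u v → ∑[ j < _ ] (+ contrib (s j u) (s j v)))
      ≡⟨ quadForm-∑ w (λ j u v → + contrib (s j u) (s j v)) ⟩
    ∑[ j < _ ] quadForm w (λ u v → + contrib (s j u) (s j v))
      ≡⟨ sum-cong-≗ coordinate ⟩
    ∑[ j < _ ] (mass w g is𝟎 j * mass w g is𝟏 j + mass w g is𝟏 j * mass w g is𝟎 j) ∎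
    where
    open ≡-Reasoning
    s : Fin _ → V → Sym
    s j u = Vec.lookup (g u) j
    coordinate : ∀ j → quadForm w (λ u v → + contrib (s j u) (s j v))
                     ≡ mass w g is𝟎 j * mass w g is𝟏 j + mass w g is𝟏 j * mass w g is𝟎 j
    coordinate j = trans (quadForm-cong w (λ u v → contrib-split (s j u) (s j v)))
                  (trans (quadForm-+ w (λ u v → is𝟎 (s j u) * is𝟏 (s j v)) (λ u v → is𝟏 (s j u) * is𝟎 (s j v)))
                         (cong₂ _+_ (quadForm-⊗ w (is𝟎 ∘ s j) (is𝟏 ∘ s j)) (quadForm-⊗ w (is𝟏 ∘ s j) (is𝟎 ∘ s j))))

vertexSummation : ∀ a b → Summation (Part₃ a b 1)
vertexSummation a b = ⊎-summation (finSummation a) (⊎-summation (finSummation b) (finSummation 1))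

module LowerBound (a b : ℕ) where

  open Summation (vertexSummation a b) using (∑ᵥ)
  open QuadraticForm (vertexSummation a b)

  weights : Vector ℤ a → Vector ℤ b → Part₃ a b 1 → ℤ
  weights x y (inj₁ i)        = x i
  weights x y (inj₂ (inj₁ k)) = y k
  weights x y (inj₂ (inj₂ _)) = - (sum x + sum y)

  quadForm-K : ∀ x y → quadForm (weights x y) (λ u v → + distK u v)
                     ≡ -[1+ 1 ] * (sum x * sum y + (‖ x ‖² + ‖ y ‖²))
  quadForm-K x y = begin
    quadForm w (λ u v → + distK u v)
      ≡⟨ cong₂ _+_ (sum-cong-≗ (λ i → cong (x i *_) (row-A i)))
                   (cong₂ _+_ (sum-cong-≗ (λ k → cong (y k *_) (row-B k)))
                              (cong (λ r → s * r + 0ℤ) row-apex)) ⟩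
    ∑[ i < a ] (x i * (cA + -[1+ 1 ] * x i))
      + (∑[ k < b ] (y k * (cB + -[1+ 1 ] * y k)) + (s * (sum x + sum y) + 0ℤ))
      ≡⟨ cong₂ _+_ (∑-*-affine x cA -[1+ 1 ]) (cong (_+ (s * (sum x + sum y) + 0ℤ)) (∑-*-affine y cB -[1+ 1 ])) ⟩
    cA * sum x + -[1+ 1 ] * ‖ x ‖² + (cB * sum y + -[1+ 1 ] * ‖ y ‖² + (s * (sum x + sum y) + 0ℤ))
      ≡⟨ collect (sum x) (sum y) ‖ x ‖² ‖ y ‖² ⟩
    -[1+ 1 ] * (sum x * sum y + (‖ x ‖² + ‖ y ‖²)) ∎
    where
    open ≡-Reasoning
    w = weights x y
    s = - (sum x + sum y)
    cA = + 2 * sum x + sum y + s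
    cB = sum x + + 2 * sum y + s
    row-A : ∀ i → ∑ᵥ (λ v → w v * + distK (inj₁ i) v) ≡ cA + -[1+ 1 ] * x i
    row-A i = trans (cong₂ _+_ (∑-*-samePartDist x i) (cong (_+ (s * 1ℤ + 0ℤ)) (∑-*-identityʳ y)))
                    (rearrange (sum x) (sum y) s (x i))
      where
      rearrange : ∀ A B s xᵢ → + 2 * A + -[1+ 1 ] * xᵢ + (B + (s * 1ℤ + 0ℤ)) ≡ + 2 * A + B + s + -[1+ 1 ] * xᵢ
      rearrange = solve-∀
    row-B : ∀ k → ∑ᵥ (λ v → w v * + distK (inj₂ (inj₁ k)) v) ≡ cB + -[1+ 1 ] * y k
    row-B k = trans (cong₂ _+_ (∑-*-identityʳ x) (cong (_+ (s * 1ℤ + 0ℤ)) (∑-*-samePartDist y k)))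
                    (rearrange (sum x) (sum y) s (y k))
      where
      rearrange : ∀ A B s yₖ → A + (+ 2 * B + -[1+ 1 ] * yₖ + (s * 1ℤ + 0ℤ)) ≡ A + + 2 * B + s + -[1+ 1 ] * yₖ
      rearrange = solve-∀
    row-apex : ∑ᵥ (λ v → w v * + distK apex v) ≡ sum x + sum y
    row-apex = trans (cong₂ _+_ (∑-*-identityʳ x) (cong (_+ (s * 0ℤ + 0ℤ)) (∑-*-identityʳ y)))
                     (rearrange (sum x) (sum y) s)
      where
      rearrange : ∀ A B s → A + (B + (s * 0ℤ + 0ℤ)) ≡ A + B
      rearrange = solve-∀
    collect : ∀ A B p q →
      (+ 2 * A + B + - (A + B)) * A + -[1+ 1 ] * p
        + ((A + + 2 * B + - (A + B)) * B + -[1+ 1 ] * q + (- (A + B) * (A + B) + 0ℤ))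
      ≡ -[1+ 1 ] * (A * B + (p + q))
    collect = solve-∀

  ‖x‖²+‖y‖²≡0 : ∀ x y → sum x ≡ sum y → quadForm (weights x y) (λ u v → + distK u v) ≡ 0ℤ →
                ‖ x ‖² + ‖ y ‖² ≡ 0ℤ
  ‖x‖²+‖y‖²≡0 x y Σx≡Σy form≡0 =
    i+j≡0⇒j≡0 (0≤i*i (sum x)) (ℤₚ.+-mono-≤ (0≤‖‖² x) (0≤‖‖² y)) square+norms≡0
    where
    scaled≡0 : -[1+ 1 ] * (sum x * sum x + (‖ x ‖² + ‖ y ‖²)) ≡ 0ℤ
    scaled≡0 = trans (cong (λ t → -[1+ 1 ] * (sum x * t + (‖ x ‖² + ‖ y ‖²))) Σx≡Σy)
                     (trans (sym (quadForm-K x y)) form≡0)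
    square+norms≡0 : sum x * sum x + (‖ x ‖² + ‖ y ‖²) ≡ 0ℤ
    square+norms≡0 = [ (λ ()) , id ]′ (ℤₚ.i*j≡0⇒i≡0∨j≡0 -[1+ 1 ] scaled≡0)

  dual : (Part₃ a b 1 → ℤ) → Vector ℤ (a ℕ.+ b)
  dual c = (λ i → c (inj₁ i) - c apex) ++ (λ k → c (inj₂ (inj₁ k)) - c apex)

  weightsOf : Vector ℤ (a ℕ.+ b) → Part₃ a b 1 → ℤ
  weightsOf v = weights (v ∘ (_↑ˡ b)) (v ∘ (a ↑ʳ_))

  dual-· : ∀ c v → dual c · v ≡ ∑ᵥ (λ u → weightsOf v u * c u)
  dual-· c v =
    trans (·-++ (λ i → c (inj₁ i) - c apex) (λ k → c (inj₂ (inj₁ k)) - c apex) v)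
    (trans (cong₂ _+_ (∑-shift (c ∘ inj₁) (c apex) x) (∑-shift (c ∘ inj₂ ∘ inj₁) (c apex) y))
           (rearrange (∑[ i < a ] (x i * c (inj₁ i))) (∑[ k < b ] (y k * c (inj₂ (inj₁ k))))
                      (c apex) (sum x) (sum y)))
    where
    x = v ∘ (_↑ˡ b)
    y = v ∘ (a ↑ʳ_)
    ∑-shift : ∀ {n} (f : Vector ℤ n) t (z : Vector ℤ n) →
              (λ i → f i - t) · z ≡ ∑[ i < n ] (z i * f i) + - t * sum z
    ∑-shift f t z = trans (sum-cong-≗ (λ i → distribute (f i) t (z i)))
                     (trans (∑-distrib-+ (λ i → z i * f i) (λ i → - t * z i))
                            (cong (_+_ (∑[ i < _ ] (z i * f i))) (sym (*-distribˡ-sum (- t) z))))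
      where
      distribute : ∀ f t z → (f - t) * z ≡ z * f + - t * z
      distribute = solve-∀
    rearrange : ∀ P Q t A B → P + - t * A + (Q + - t * B) ≡ P + (Q + (- (A + B) * t + 0ℤ))
    rearrange = solve-∀

  side : Part₃ a b 1 → ℤ
  side (inj₁ _)        = 1ℤ
  side (inj₂ (inj₁ _)) = -[1+ 0 ]
  side (inj₂ (inj₂ _)) = 0ℤ

  ∑ᵥ-side : ∀ x y → ∑ᵥ (λ u → weights x y u * side u) ≡ sum x - sum y
  ∑ᵥ-side x y =
    trans (cong₂ _+_ (∑-*-identityʳ x)
                     (cong (_+ (- (sum x + sum y) * 0ℤ + 0ℤ))
                           (trans (sum-cong-≗ (λ k → ℤₚ.*-comm (y k) -[1+ 0 ])) (sym (*-distribˡ-sum -[1+ 0 ] y)))))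
          (rearrange (sum x) (sum y))
    where
    rearrange : ∀ A B → A + (-[1+ 0 ] * B + (- (A + B) * 0ℤ + 0ℤ)) ≡ A - B
    rearrange = solve-∀

  at𝟎 : ∀ {N} → (Part₃ a b 1 → Vec Sym N) → Fin N → Part₃ a b 1 → ℤ
  at𝟎 g j u = is𝟎 (Vec.lookup (g u) j)

  constraints : ∀ {N} → (Part₃ a b 1 → Vec Sym N) → List (Part₃ a b 1 → ℤ)
  constraints g = side List.∷ List.tabulate (at𝟎 g)

  dual-constraints-trivial : ∀ {N} (g : Part₃ a b 1 → Vec Sym N) → IsAddressing (K a b 1) N g →
    ∀ v → All (λ c → dual c · v ≡ 0ℤ) (constraints g) → ∀ t → v t ≡ 0ℤ
  dual-constraints-trivial {N} g isAddr v v⊥ = ‖‖²≡0⇒≡0 v ‖v‖²≡0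
    where
    x = v ∘ (_↑ˡ b)
    y = v ∘ (a ↑ʳ_)
    w = weights x y
    orthogonal : All (λ c → ∑ᵥ (λ u → w u * c u) ≡ 0ℤ) (constraints g)
    orthogonal = All.map (λ {c} → trans (sym (dual-· c v))) v⊥
    balanced : sum x ≡ sum y
    balanced = ℤₚ.i-j≡0⇒i≡j (sum x) (sum y) (trans (sym (∑ᵥ-side x y)) (All.head orthogonal))
    massless : ∀ j → mass w g is𝟎 j ≡ 0ℤ
    massless = tabulate⁻ (All.tail orthogonal)
    form≡0 : quadForm w (λ u v → + distK u v) ≡ 0ℤ
    form≡0 = begin
      quadForm w (λ u v → + distK u v)
        ≡⟨ quadForm-cong w (λ u v → cong +_ (isDist-unique (isDist-K u v) (isAddr u v))) ⟩
      quadForm w (λ u v → + sqDist (g u) (g v))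
        ≡⟨ quadForm-sqDist w g ⟩
      ∑[ j < N ] (mass w g is𝟎 j * mass w g is𝟏 j + mass w g is𝟏 j * mass w g is𝟎 j)
        ≡⟨ ∑-zero (λ j → trans (cong₂ (λ m m′ → m * mass w g is𝟏 j + mass w g is𝟏 j * m′) (massless j) (massless j))
                               (trans (ℤₚ.+-identityˡ _) (ℤₚ.*-zeroʳ (mass w g is𝟏 j)))) ⟩
      0ℤ ∎
      where open ≡-Reasoning
    ‖v‖²≡0 : ‖ v ‖² ≡ 0ℤ
    ‖v‖²≡0 = trans (∑-↑ a (λ i → v i * v i)) (‖x‖²+‖y‖²≡0 x y balanced form≡0)

  no-short-addressing : ∀ {N} (g : Part₃ a b 1 → Vec Sym N) → IsAddressing (K a b 1) N g →
                        ¬ (suc N ℕ.< a ℕ.+ b)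
  no-short-addressing {N} g isAddr N+1<a+b
    with ∃-nonzero-solution (List.map dual (constraints g)) (subst (ℕ._< a ℕ.+ b) (sym #constraints) N+1<a+b)
    where
    #constraints : length (List.map dual (constraints g)) ≡ suc N
    #constraints = cong suc (trans (length-map dual (List.tabulate (at𝟎 g))) (length-tabulate (at𝟎 g)))
  ... | v , (t , vₜ≢0) , v⊥ = vₜ≢0 (dual-constraints-trivial g isAddr v (map⁻ v⊥) t)

mainTheorem14 : (a b : ℕ) → 2 ≤ a → 2 ≤ b → N₂≡ (K a b 1) (a ℕ.+ b ℕ.∸ 1)
mainTheorem14 (suc zero)    _             (s≤s ()) _
mainTheorem14 _             (suc zero)    _        (s≤s ())
mainTheorem14 (suc (suc p)) (suc (suc q)) _        _        = (encode ∘ layoutK , addressingK) , minimal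
  where
  minimal : ∀ N → HasAddressing (K (2 ℕ.+ p) (2 ℕ.+ q) 1) N → suc (p ℕ.+ suc (suc q)) ≤ N
  minimal N (g , isAddr) = ℕₚ.≤-pred (ℕₚ.≮⇒≥ (LowerBound.no-short-addressing _ _ g isAddr))
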